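{- For every $0\le i\le k$ and every pair $a,b\in D^k$ differing in exactly $i$ coordinates, the conditional probability $p_i$ that a uniformly random $C\in\Gamma$ satisfies $C(b)=\mathrm{true}$ given $C(a)=\mathrm{true}$ satisfies $\sum_{i=0}^k\binom{k}{i}p_i z^i=p(z)$, where $p(z)=\frac1d\left[(1+z)^k+(d-1)\left(1-\frac{z}{d-1}\right)^k\right]$; equivalently $p_i=\frac1d\left(1+(-1)^i\left(\frac1{d-1}\right)^{i-1}\right)$.
   Context: $D$ is a finite domain with $d=|D|\ge2$, $k\ge 2$ an integer, and $\Gamma$ is the set of all $k$-ary uniquely extendible constraints over $D$: functions $C:D^k\to\{\mathrm{true},\mathrm{false}\}$ such that for every position and every choice of values of the other $k-1$ positions, exactly one value at that position makes $C$ true. -}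

module Defs where

open import Data.Bool using (Bool; true; false; if_then_else_; _∧_)
open import Data.Nat using (ℕ; zero; suc)
open import Data.Fin using (Fin)
open import Data.Fin.Properties using (all?; any?) renaming (_≟_ to _≟ᶠ_)
open import Data.Vec using (Vec; []; _∷_; _[_]≔_; count; zip)
open import Data.Vec.Properties using (≡-dec)
open import Data.List using (List; []; _∷_; [_]; concatMap; map; filter; length; allFin)
open import Data.Product using (Σ; _×_; _,_; proj₁; proj₂)
open import Relation.Binary.PropositionalEquality using (_≡_; refl)
open import Relation.Nullary using (Dec; yes; no; ¬_; does)
open import Relation.Nullary.Decidable using (_×-dec_; _→-dec_; ¬?; map′)
open import Relation.Unary using (Decidable)
open import Data.Bool.Properties using () renaming (_≟_ to _≟ᵇ_)

Tuple : ℕ → ℕ → Set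
Tuple d k = Vec (Fin d) k

Constraint : ℕ → ℕ → Set
Constraint d k = Tuple d k → Bool

ExactlyOne : {d : ℕ} → (Fin d → Set) → Set
ExactlyOne {d} P = Σ (Fin d) λ v → P v × (∀ w → P w → w ≡ v)

-- C is uniquely extendible: for every position j and every choice of the
-- other k-1 coordinates (given by t, whose j-th entry is overwritten),
-- exactly one value v at position j makes C true.
UniquelyExtendible : {d k : ℕ} → Constraint d k → Set
UniquelyExtendible {d} {k} C =
  (t : Tuple d k) (j : Fin k) → ExactlyOne (λ v → C (t [ j ]≔ v) ≡ true)

hamming : {d k : ℕ} → Tuple d k → Tuple d k → ℕ
hamming a b = count (λ p → ¬? (proj₁ p ≟ᶠ proj₂ p)) (zip a b)

tuples : (d k : ℕ) → List (Tuple d k)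
tuples d zero = [ [] ]
tuples d (suc k) = concatMap (λ x → map (x ∷_) (tuples d k)) (allFin d)

-- Enumeration of all Boolean functions on a type X, given a duplicate-free
-- complete list xs of X: one function per assignment of truth values to xs
-- (2^|xs| functions, pairwise different on xs).
allPreds : {X : Set} → ((x y : X) → Dec (x ≡ y)) → List X → List (X → Bool)
allPreds eq [] = [ (λ _ → false) ]
allPreds eq (x ∷ xs) =
  concatMap (λ f → (λ y → if does (eq x y) then true else f y)
                 ∷ (λ y → if does (eq x y) then false else f y) ∷ [])
            (allPreds eq xs)

allConstraints : (d k : ℕ) → List (Constraint d k)
allConstraints d k = allPreds (≡-dec _≟ᶠ_) (tuples d k)

private
  allVec? : {d : ℕ} (k : ℕ) {P : Tuple d k → Set} → Decidable P → Dec (∀ t → P t)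
  allVec? zero P? = map′ (λ { p [] → p }) (λ f → f []) (P? [])
  allVec? (suc k) P? =
    map′ (λ f → λ { (x ∷ t) → f x t }) (λ f x t → f (x ∷ t))
         (all? (λ x → allVec? k (λ t → P? (x ∷ t))))

  exactlyOne? : {d : ℕ} {P : Fin d → Set} → Decidable P → Dec (ExactlyOne P)
  exactlyOne? P? =
    map′ (λ { (v , pv , u) → v , pv , u }) (λ { (v , pv , u) → v , pv , u })
         (any? (λ v → P? v ×-dec all? (λ w → P? w →-dec (w ≟ᶠ v))))

UniquelyExtendible? : {d k : ℕ} → Decidable (UniquelyExtendible {d} {k})
UniquelyExtendible? {d} {k} C =
  allVec? k (λ t → all? (λ j → exactlyOne? (λ v → C (t [ j ]≔ v) ≟ᵇ true)))

Γ : (d k : ℕ) → List (Constraint d k)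
Γ d k = filter UniquelyExtendible? (allConstraints d k)

countSat₁ : {d k : ℕ} → Tuple d k → ℕ
countSat₁ {d} {k} a = length (filter (λ C → C a ≟ᵇ true) (Γ d k))

countSat₂ : {d k : ℕ} → Tuple d k → Tuple d k → ℕ
countSat₂ {d} {k} a b =
  length (filter (λ C → (C a ≟ᵇ true) ×-dec (C b ≟ᵇ true)) (Γ d k))

module Submission where

-- Let N₁ a and N₂ a b count the C ∈ Γ that are true at a, resp. at both a and b.
-- Unique extendibility at a coordinate j gives Σ_v N₂ a (b[j]≔v) = N₁ a.  Permuting
-- the values of coordinate j by a permutation fixing a_j maps Γ onto itself, so if
-- a_j ≠ b_j then N₂ a (b[j]≔v) = N₂ a b =: X for every v ≠ a_j.  Hence
-- N₁ a = Y + (d-1) X with Y = N₂ a (b[j]≔a_j), where b[j]≔a_j is one step closer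
-- to a, and the formula follows by induction on the Hamming distance.  Finally
-- N₁ a > 0 because "the coordinate sum of t is that of a, modulo d" is uniquely
-- extendible.

open import Defs
open import Data.Nat using (ℕ; _≤_; _<_; _∸_; _*_; _^_)
open import Data.Integer using (ℤ; +_; -_) renaming (_*_ to _*ℤ_; _+_ to _+ℤ_; _^_ to _^ℤ_)
open import Data.Product using (_×_)
open import Relation.Binary.PropositionalEquality using (_≡_)

open import Data.Bool using (Bool; true; false; if_then_else_)
open import Data.Bool.Properties using () renaming (_≟_ to _≟ᵇ_)
open import Data.Nat using (zero; suc; _+_; _%_; _/_; NonZero; z≤n; s≤s) renaming (_≟_ to _≟ℕ_)
open import Data.Nat.Properties
open import Data.Nat.DivMod using (m≡m%n+[m/n]*n; m%n<n; m%n%n≡m%n; m<n⇒m%n≡m; [m+kn]%n≡m%n; %-distribˡ-+)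
open import Algebra.Properties.CommutativeSemigroup +-commutativeSemigroup using (interchange; x∙yz≈y∙xz; xy∙z≈xz∙y)
import Data.Integer.Tactic.RingSolver as ℤ-Solver
open import Data.Integer.Properties using (pos-*; pos-+)
open import Data.Fin using (Fin; zero; suc; toℕ; fromℕ<) renaming (_≟_ to _≟ᶠ_)
open import Data.Fin.Properties using (toℕ-injective; toℕ-fromℕ<; toℕ<n)
open import Data.Fin.Permutation using (Permutation′; _⟨$⟩ʳ_; _⟨$⟩ˡ_; inverseˡ; inverseʳ; flip; transpose)
open import Data.Vec using ([]; _∷_; lookup; _[_]≔_; _[_]%=_; removeAt)
open import Data.Vec.Properties using (≡-dec; ∷-injective; updateAt-updateAt; updateAt-id-local; updateAt-cong-local; updateAt-commutes)
open import Data.List using (List; []; _∷_; concatMap; concat; map; filter; length; allFin; _++_)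
open import Data.List.Properties using (length-tabulate)
open import Data.List.Relation.Unary.All as All using (All; []; _∷_)
open import Data.List.Relation.Unary.AllPairs using ([]; _∷_)
open import Data.List.Relation.Unary.Any using (here; there)
open import Data.List.Relation.Unary.Unique.Propositional using (Unique)
open import Data.List.Relation.Unary.Unique.Propositional.Properties using (allFin⁺)
open import Data.List.Membership.Propositional using (_∈_; _∉_)
open import Data.List.Membership.Propositional.Properties using (∈-allFin)
open import Data.Product using (Σ; _,_; proj₁)
open import Function using (_∘_)
open import Relation.Binary using (DecidableEquality)
open import Relation.Binary.PropositionalEquality using (refl; sym; trans; cong; cong₂; subst; _≗_; _≢_; module ≡-Reasoning)
open import Relation.Nullary using (Dec; yes; no; ¬_; does; contradiction)
open import Relation.Nullary.Decidable using (_×-dec_; dec-true; dec-false)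
open import Relation.Unary using (Decidable)

open ≡-Reasoning

𝟙 : {P : Set} → Dec P → ℕ
𝟙 p = if does p then 1 else 0

𝟙-yes : {P : Set} → P → (p : Dec P) → 𝟙 p ≡ 1
𝟙-yes x p rewrite dec-true p x = refl

𝟙-no : {P : Set} → ¬ P → (p : Dec P) → 𝟙 p ≡ 0
𝟙-no ¬x p rewrite dec-false p ¬x = refl

𝟙-cong : {P Q : Set} → (P → Q) → (Q → P) → (p : Dec P) (q : Dec Q) → 𝟙 p ≡ 𝟙 q
𝟙-cong f g (yes x) q = sym (𝟙-yes (f x) q)
𝟙-cong f g (no ¬x) q = sym (𝟙-no (¬x ∘ g) q)

𝟙-× : {P Q : Set} (p : Dec P) (q : Dec Q) → 𝟙 (p ×-dec q) ≡ 𝟙 p * 𝟙 q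
𝟙-× (yes _) (yes _) = refl
𝟙-× (yes _) (no _)  = refl
𝟙-× (no _)  _       = refl

∑ : {A : Set} → List A → (A → ℕ) → ℕ
∑ []       f = 0
∑ (x ∷ xs) f = f x + ∑ xs f

module _ {A : Set} where

  ∑-cong : (xs : List A) {f g : A → ℕ} → (∀ x → f x ≡ g x) → ∑ xs f ≡ ∑ xs g
  ∑-cong []       f≗g = refl
  ∑-cong (x ∷ xs) f≗g = cong₂ _+_ (f≗g x) (∑-cong xs f≗g)

  ∑-+ : (xs : List A) (f g : A → ℕ) → ∑ xs (λ x → f x + g x) ≡ ∑ xs f + ∑ xs g
  ∑-+ []       f g = refl
  ∑-+ (x ∷ xs) f g rewrite ∑-+ xs f g = interchange (f x) (g x) (∑ xs f) (∑ xs g)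

  ∑-*ˡ : (xs : List A) (c : ℕ) (f : A → ℕ) → ∑ xs (λ x → c * f x) ≡ c * ∑ xs f
  ∑-*ˡ []       c f = sym (*-zeroʳ c)
  ∑-*ˡ (x ∷ xs) c f rewrite ∑-*ˡ xs c f = sym (*-distribˡ-+ c (f x) (∑ xs f))

  ∑-*ʳ : (xs : List A) (c : ℕ) (f : A → ℕ) → ∑ xs (λ x → f x * c) ≡ ∑ xs f * c
  ∑-*ʳ xs c f = begin
    ∑ xs (λ x → f x * c)  ≡⟨ ∑-cong xs (λ x → *-comm (f x) c) ⟩
    ∑ xs (λ x → c * f x)  ≡⟨ ∑-*ˡ xs c f ⟩
    c * ∑ xs f            ≡⟨ *-comm c _ ⟩
    ∑ xs f * c            ∎

  ∑-const : (xs : List A) (c : ℕ) → ∑ xs (λ _ → c) ≡ length xs * c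
  ∑-const []       c = refl
  ∑-const (x ∷ xs) c = cong (_+_ c) (∑-const xs c)

  ∑-++ : (xs ys : List A) (f : A → ℕ) → ∑ (xs ++ ys) f ≡ ∑ xs f + ∑ ys f
  ∑-++ []       ys f = refl
  ∑-++ (x ∷ xs) ys f rewrite ∑-++ xs ys f = sym (+-assoc (f x) _ _)

  ∑-mono : (xs : List A) {f g : A → ℕ} → (∀ x → f x ≤ g x) → ∑ xs f ≤ ∑ xs g
  ∑-mono []       f≤g = z≤n
  ∑-mono (x ∷ xs) f≤g = +-mono-≤ (f≤g x) (∑-mono xs f≤g)

  length-filter-filter : {P Q : A → Set} (P? : Decidable P) (Q? : Decidable Q) (xs : List A) →
                         length (filter Q? (filter P? xs)) ≡ ∑ xs (λ x → 𝟙 (P? x) * 𝟙 (Q? x))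
  length-filter-filter P? Q? [] = refl
  length-filter-filter P? Q? (x ∷ xs) with does (P? x)
  ... | false = length-filter-filter P? Q? xs
  ... | true with does (Q? x)
  ...   | true  = cong suc (length-filter-filter P? Q? xs)
  ...   | false = length-filter-filter P? Q? xs

module _ {A B : Set} where

  ∑-map : (xs : List A) (g : A → B) (f : B → ℕ) → ∑ (map g xs) f ≡ ∑ xs (f ∘ g)
  ∑-map []       g f = refl
  ∑-map (x ∷ xs) g f = cong (_+_ (f (g x))) (∑-map xs g f)

  ∑-concatMap : (xs : List A) (g : A → List B) (f : B → ℕ) →
                ∑ (concatMap g xs) f ≡ ∑ xs (λ x → ∑ (g x) f)
  ∑-concatMap []       g f = refl
  ∑-concatMap (x ∷ xs) g f =
    trans (∑-++ (g x) (concat (map g xs)) f) (cong (_+_ (∑ (g x) f)) (∑-concatMap xs g f))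

  ∑-comm : (xs : List A) (ys : List B) (f : A → B → ℕ) →
           ∑ xs (λ x → ∑ ys (f x)) ≡ ∑ ys (λ y → ∑ xs (λ x → f x y))
  ∑-comm []       ys f = sym (trans (∑-const ys 0) (*-zeroʳ (length ys)))
  ∑-comm (x ∷ xs) ys f = begin
    ∑ ys (f x) + ∑ xs (λ x → ∑ ys (f x))           ≡⟨ cong (_+_ (∑ ys (f x))) (∑-comm xs ys f) ⟩
    ∑ ys (f x) + ∑ ys (λ y → ∑ xs (λ x → f x y))   ≡⟨ ∑-+ ys (f x) _ ⟨
    ∑ ys (λ y → f x y + ∑ xs (λ x → f x y))        ∎

module _ {A : Set} (_≟_ : DecidableEquality A) where

  multiplicity : List A → A → ℕ
  multiplicity xs x = ∑ xs (λ y → 𝟙 (y ≟ x))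

  multiplicity-∉ : ∀ {x} xs → x ∉ xs → multiplicity xs x ≡ 0
  multiplicity-∉     []       x∉ = refl
  multiplicity-∉ {x} (y ∷ xs) x∉ rewrite 𝟙-no (λ y≡x → x∉ (here (sym y≡x))) (y ≟ x) =
    multiplicity-∉ xs (x∉ ∘ there)

  Unique⇒multiplicity≡1 : ∀ {x xs} → Unique xs → x ∈ xs → multiplicity xs x ≡ 1
  Unique⇒multiplicity≡1 {x} {y ∷ xs} (y∉xs ∷ _) (here refl) rewrite 𝟙-yes refl (x ≟ x) =
    cong suc (multiplicity-∉ xs (λ x∈xs → All.lookup y∉xs x∈xs refl))
  Unique⇒multiplicity≡1 {x} {y ∷ xs} (y∉xs ∷ u) (there x∈xs)
    rewrite 𝟙-no (All.lookup y∉xs x∈xs) (y ≟ x) = Unique⇒multiplicity≡1 u x∈xs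

  ∈⇒multiplicity≥1 : ∀ {x xs} → x ∈ xs → 1 ≤ multiplicity xs x
  ∈⇒multiplicity≥1 {x} (here refl) rewrite 𝟙-yes refl (x ≟ x) = s≤s z≤n
  ∈⇒multiplicity≥1 {x} {y ∷ _} (there x∈xs) = ≤-trans (∈⇒multiplicity≥1 x∈xs) (m≤n+m _ (𝟙 (y ≟ x)))

  multiplicity≥1⇒∈ : ∀ {x} xs → 1 ≤ multiplicity xs x → x ∈ xs
  multiplicity≥1⇒∈     []       ()
  multiplicity≥1⇒∈ {x} (y ∷ xs) h with y ≟ x
  ... | yes refl = here refl
  ... | no _     = there (multiplicity≥1⇒∈ xs h)

  multiplicity≤1⇒Unique : ∀ xs → (∀ x → multiplicity xs x ≤ 1) → Unique xs
  multiplicity≤1⇒Unique []       _ = []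
  multiplicity≤1⇒Unique (y ∷ xs) h =
    All.tabulate (λ z∈xs y≡z → y∉xs (subst (_∈ xs) (sym y≡z) z∈xs))
    ∷ multiplicity≤1⇒Unique xs (λ x → ≤-trans (m≤n+m _ (𝟙 (y ≟ x))) (h x))
    where
    y∉xs : y ∉ xs
    y∉xs y∈xs with h y
    ... | 1+m≤1 rewrite 𝟙-yes refl (y ≟ y) =
      contradiction (≤-trans (∈⇒multiplicity≥1 y∈xs) (≤-pred 1+m≤1)) λ ()

_≟ᵗ_ : {d k : ℕ} → DecidableEquality (Tuple d k)
_≟ᵗ_ = ≡-dec _≟ᶠ_

multiplicity-allFin : ∀ {d} (x : Fin d) → multiplicity _≟ᶠ_ (allFin d) x ≡ 1
multiplicity-allFin {d} x = Unique⇒multiplicity≡1 _≟ᶠ_ (allFin⁺ d) (∈-allFin x)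

∑-allFin-except : ∀ {d} (g : Fin d → ℕ) (x : Fin d) (X : ℕ) → (∀ v → v ≢ x → g v ≡ X) →
                  ∑ (allFin d) g + X ≡ g x + d * X
∑-allFin-except {d} g x X g≡X = begin
    ∑ (allFin d) g + X
  ≡⟨ cong (_+_ (∑ (allFin d) g)) (trans (∑-*ʳ (allFin d) X _)
                                (trans (cong (_* X) (multiplicity-allFin x)) (*-identityˡ X))) ⟨
    ∑ (allFin d) g + ∑ (allFin d) (λ v → 𝟙 (v ≟ᶠ x) * X)
  ≡⟨ ∑-+ (allFin d) g _ ⟨
    ∑ (allFin d) (λ v → g v + 𝟙 (v ≟ᶠ x) * X)
  ≡⟨ ∑-cong (allFin d) move ⟩
    ∑ (allFin d) (λ v → 𝟙 (v ≟ᶠ x) * g x + X)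
  ≡⟨ ∑-+ (allFin d) _ (λ _ → X) ⟩
    ∑ (allFin d) (λ v → 𝟙 (v ≟ᶠ x) * g x) + ∑ (allFin d) (λ _ → X)
  ≡⟨ cong₂ _+_ (trans (∑-*ʳ (allFin d) (g x) _) (trans (cong (_* g x) (multiplicity-allFin x)) (*-identityˡ _)))
               (trans (∑-const (allFin d) X) (cong (_* X) (length-tabulate {n = d} (λ v → v)))) ⟩
    g x + d * X
  ∎
  where
  move : ∀ v → g v + 𝟙 (v ≟ᶠ x) * X ≡ 𝟙 (v ≟ᶠ x) * g x + X
  move v with v ≟ᶠ x
  ... | yes refl = cong₂ _+_ (sym (*-identityˡ (g v))) (*-identityˡ X)
  ... | no  v≢x  = trans (+-identityʳ (g v)) (g≡X v v≢x)

𝟙-∷ : ∀ {d k} (x y : Fin d) (s t : Tuple d k) → 𝟙 ((x ∷ s) ≟ᵗ (y ∷ t)) ≡ 𝟙 (x ≟ᶠ y) * 𝟙 (s ≟ᵗ t)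
𝟙-∷ x y s t = trans (𝟙-cong ∷-injective (λ { (refl , refl) → refl }) ((x ∷ s) ≟ᵗ (y ∷ t)) ((x ≟ᶠ y) ×-dec (s ≟ᵗ t)))
                    (𝟙-× (x ≟ᶠ y) (s ≟ᵗ t))

multiplicity-tuples : ∀ d k (t : Tuple d k) → multiplicity _≟ᵗ_ (tuples d k) t ≡ 1
multiplicity-tuples d zero    [] = refl
multiplicity-tuples d (suc k) (x ∷ t) = begin
    ∑ (concatMap (λ z → map (z ∷_) (tuples d k)) (allFin d)) (λ s → 𝟙 (s ≟ᵗ (x ∷ t)))
  ≡⟨ ∑-concatMap (allFin d) _ _ ⟩
    ∑ (allFin d) (λ z → ∑ (map (z ∷_) (tuples d k)) (λ s → 𝟙 (s ≟ᵗ (x ∷ t))))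
  ≡⟨ ∑-cong (allFin d) (λ z → ∑-map (tuples d k) (z ∷_) _) ⟩
    ∑ (allFin d) (λ z → ∑ (tuples d k) (λ s → 𝟙 ((z ∷ s) ≟ᵗ (x ∷ t))))
  ≡⟨ ∑-cong (allFin d) (λ z → ∑-cong (tuples d k) (λ s → 𝟙-∷ z x s t)) ⟩
    ∑ (allFin d) (λ z → ∑ (tuples d k) (λ s → 𝟙 (z ≟ᶠ x) * 𝟙 (s ≟ᵗ t)))
  ≡⟨ ∑-cong (allFin d) (λ z → ∑-*ˡ (tuples d k) (𝟙 (z ≟ᶠ x)) _) ⟩
    ∑ (allFin d) (λ z → 𝟙 (z ≟ᶠ x) * multiplicity _≟ᵗ_ (tuples d k) t)
  ≡⟨ ∑-cong (allFin d) (λ z → cong (𝟙 (z ≟ᶠ x) *_) (multiplicity-tuples d k t)) ⟩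
    ∑ (allFin d) (λ z → 𝟙 (z ≟ᶠ x) * 1)
  ≡⟨ ∑-cong (allFin d) (λ z → *-identityʳ _) ⟩
    multiplicity _≟ᶠ_ (allFin d) x
  ≡⟨ multiplicity-allFin x ⟩
    1
  ∎

tuples-Unique : ∀ d k → Unique (tuples d k)
tuples-Unique d k = multiplicity≤1⇒Unique _≟ᵗ_ (tuples d k) (λ t → ≤-reflexive (multiplicity-tuples d k t))

∈-tuples : ∀ {d k} (t : Tuple d k) → t ∈ tuples d k
∈-tuples {d} {k} t = multiplicity≥1⇒∈ _≟ᵗ_ (tuples d k) (≤-reflexive (sym (multiplicity-tuples d k t)))

module _ {A : Set} (_≟_ : DecidableEquality A) where

  Agree : List A → (A → Bool) → (A → Bool) → Set
  Agree xs g f = All (λ y → g y ≡ f y) xs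

  agree? : ∀ xs g f → Dec (Agree xs g f)
  agree? xs g f = All.all? (λ y → g y ≟ᵇ f y) xs

  override : Bool → A → (A → Bool) → A → Bool
  override b x h y = if does (x ≟ y) then b else h y

  override-agree : ∀ b x h f {xs} → All (x ≢_) xs → Agree xs (override b x h) f → Agree xs h f
  override-agree b x h f x∉xs agr = All.zipWith away (x∉xs , agr)
    where
    away : ∀ {y} → x ≢ y × override b x h y ≡ f y → h y ≡ f y
    away {y} (x≢y , e) rewrite dec-false (x ≟ y) x≢y = e

  agree-override : ∀ b x h f {xs} → All (x ≢_) xs → Agree xs h f → Agree xs (override b x h) f
  agree-override b x h f x∉xs agr = All.zipWith away (x∉xs , agr)
    where
    away : ∀ {y} → x ≢ y × h y ≡ f y → override b x h y ≡ f y
    away {y} (x≢y , e) rewrite dec-false (x ≟ y) x≢y = e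

  𝟙-agree-override : ∀ b x h f xs → All (x ≢_) xs →
    𝟙 (agree? (x ∷ xs) (override b x h) f) ≡ 𝟙 (b ≟ᵇ f x) * 𝟙 (agree? xs h f)
  𝟙-agree-override b x h f xs x∉xs = trans
    (𝟙-cong (λ { (e ∷ agr) → trans (sym here-b) e , override-agree b x h f x∉xs agr })
            (λ { (e , agr) → trans here-b e ∷ agree-override b x h f x∉xs agr })
            (agree? (x ∷ xs) (override b x h) f) ((b ≟ᵇ f x) ×-dec agree? xs h f))
    (𝟙-× (b ≟ᵇ f x) (agree? xs h f))
    where
    here-b : override b x h x ≡ b
    here-b rewrite dec-true (x ≟ x) refl = refl

  allPreds-agree-once : ∀ xs → Unique xs → ∀ f → ∑ (allPreds _≟_ xs) (λ g → 𝟙 (agree? xs g f)) ≡ 1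
  allPreds-agree-once []       _            f = refl
  allPreds-agree-once (x ∷ xs) (x∉xs ∷ uxs) f = begin
      ∑ (allPreds _≟_ (x ∷ xs)) (λ g → 𝟙 (agree? (x ∷ xs) g f))
    ≡⟨ ∑-concatMap (allPreds _≟_ xs) (λ h → override true x h ∷ override false x h ∷ []) _ ⟩
      ∑ (allPreds _≟_ xs) (λ h → 𝟙 (agree? (x ∷ xs) (override true x h) f)
                                + (𝟙 (agree? (x ∷ xs) (override false x h) f) + 0))
    ≡⟨ ∑-cong (allPreds _≟_ xs) both ⟩
      ∑ (allPreds _≟_ xs) (λ h → 𝟙 (agree? xs h f))
    ≡⟨ allPreds-agree-once xs uxs f ⟩
      1
    ∎
    where
    true+false : ∀ c → 𝟙 (true ≟ᵇ c) + 𝟙 (false ≟ᵇ c) ≡ 1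
    true+false true  = refl
    true+false false = refl

    both : ∀ h → 𝟙 (agree? (x ∷ xs) (override true x h) f) + (𝟙 (agree? (x ∷ xs) (override false x h) f) + 0)
               ≡ 𝟙 (agree? xs h f)
    both h rewrite +-identityʳ (𝟙 (agree? (x ∷ xs) (override false x h) f))
                 | 𝟙-agree-override true x h f xs x∉xs | 𝟙-agree-override false x h f xs x∉xs
                 | sym (*-distribʳ-+ (𝟙 (agree? xs h f)) (𝟙 (true ≟ᵇ f x)) (𝟙 (false ≟ᵇ f x)))
                 | true+false (f x) = *-identityˡ _

module _ {d k : ℕ} where

  private
    L : List (Constraint d k)
    L = allConstraints d k

  _≈ᶜ_ : Constraint d k → Constraint d k → Set
  _≈ᶜ_ = Agree _≟ᵗ_ (tuples d k)

  _≈ᶜ?_ : ∀ g f → Dec (g ≈ᶜ f)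
  _≈ᶜ?_ = agree? _≟ᵗ_ (tuples d k)

  ≈ᶜ⇒≗ : ∀ {g f} → g ≈ᶜ f → g ≗ f
  ≈ᶜ⇒≗ g≈f t = All.lookup g≈f (∈-tuples t)

  ≗⇒≈ᶜ : ∀ {g f} → g ≗ f → g ≈ᶜ f
  ≗⇒≈ᶜ g≗f = All.tabulate (λ {t} _ → g≗f t)

  allConstraints-once : ∀ f → ∑ L (λ g → 𝟙 (g ≈ᶜ? f)) ≡ 1
  allConstraints-once = allPreds-agree-once _≟ᵗ_ (tuples d k) (tuples-Unique d k)

  Extensional : (Constraint d k → ℕ) → Set
  Extensional F = ∀ {g f} → g ≗ f → F g ≡ F f

  ∑-allConstraints-sift : ∀ f (F : Constraint d k → ℕ) → Extensional F →
                          ∑ L (λ g → 𝟙 (g ≈ᶜ? f) * F g) ≡ F f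
  ∑-allConstraints-sift f F F-ext = begin
    ∑ L (λ g → 𝟙 (g ≈ᶜ? f) * F g)  ≡⟨ ∑-cong L pick ⟩
    ∑ L (λ g → 𝟙 (g ≈ᶜ? f) * F f)  ≡⟨ ∑-*ʳ L (F f) _ ⟩
    ∑ L (λ g → 𝟙 (g ≈ᶜ? f)) * F f  ≡⟨ cong (_* F f) (allConstraints-once f) ⟩
    1 * F f                        ≡⟨ *-identityˡ _ ⟩
    F f                            ∎
    where
    pick : ∀ g → 𝟙 (g ≈ᶜ? f) * F g ≡ 𝟙 (g ≈ᶜ? f) * F f
    pick g with g ≈ᶜ? f
    ... | yes g≈f = cong (1 *_) (F-ext (≈ᶜ⇒≗ g≈f))
    ... | no  _   = refl

  -- Both sides count the pairs (g , h) with h ≈ g ∘ τ, equivalently g ≈ h ∘ τ⁻¹, weighted by F h.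
  ∑-allConstraints-∘ : (τ τ⁻¹ : Tuple d k → Tuple d k) → (∀ t → τ (τ⁻¹ t) ≡ t) → (∀ t → τ⁻¹ (τ t) ≡ t) →
                       (F : Constraint d k → ℕ) → Extensional F →
                       ∑ L (λ C → F (C ∘ τ)) ≡ ∑ L F
  ∑-allConstraints-∘ τ τ⁻¹ ττ⁻¹ τ⁻¹τ F F-ext = begin
      ∑ L (λ g → F (g ∘ τ))
    ≡⟨ ∑-cong L (λ g → ∑-allConstraints-sift (g ∘ τ) F F-ext) ⟨
      ∑ L (λ g → ∑ L (λ h → 𝟙 (h ≈ᶜ? (g ∘ τ)) * F h))
    ≡⟨ ∑-comm L L _ ⟩
      ∑ L (λ h → ∑ L (λ g → 𝟙 (h ≈ᶜ? (g ∘ τ)) * F h))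
    ≡⟨ ∑-cong L (λ h → ∑-cong L (λ g → cong (_* F h)
         (𝟙-cong (≈∘τ⇒≈∘τ⁻¹ h g) (≈∘τ⁻¹⇒≈∘τ h g) (h ≈ᶜ? (g ∘ τ)) (g ≈ᶜ? (h ∘ τ⁻¹))))) ⟩
      ∑ L (λ h → ∑ L (λ g → 𝟙 (g ≈ᶜ? (h ∘ τ⁻¹)) * F h))
    ≡⟨ ∑-cong L (λ h → ∑-allConstraints-sift (h ∘ τ⁻¹) (λ _ → F h) (λ _ → refl)) ⟩
      ∑ L F
    ∎
    where
    ≈∘τ⇒≈∘τ⁻¹ : ∀ h g → h ≈ᶜ (g ∘ τ) → g ≈ᶜ (h ∘ τ⁻¹)
    ≈∘τ⇒≈∘τ⁻¹ h g h≈gτ = ≗⇒≈ᶜ (λ t → trans (cong g (sym (ττ⁻¹ t))) (sym (≈ᶜ⇒≗ h≈gτ (τ⁻¹ t))))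

    ≈∘τ⁻¹⇒≈∘τ : ∀ h g → g ≈ᶜ (h ∘ τ⁻¹) → h ≈ᶜ (g ∘ τ)
    ≈∘τ⁻¹⇒≈∘τ h g g≈hτ⁻¹ = ≗⇒≈ᶜ (λ t → trans (cong h (sym (τ⁻¹τ t))) (sym (≈ᶜ⇒≗ g≈hτ⁻¹ (τ t))))

-- Γ is closed under permuting the values of one coordinate

transpose-matchˡ : ∀ {n} (i j : Fin n) → transpose i j ⟨$⟩ʳ i ≡ j
transpose-matchˡ i j rewrite dec-true (i ≟ᶠ i) refl = refl

transpose-fix : ∀ {n} (i j k : Fin n) → k ≢ i → k ≢ j → transpose i j ⟨$⟩ʳ k ≡ k
transpose-fix i j k k≢i k≢j rewrite dec-false (k ≟ᶠ i) k≢i | dec-false (k ≟ᶠ j) k≢j = refl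

module _ {d k : ℕ} where

  UniquelyExtendible-≗ : {C C′ : Constraint d k} → C ≗ C′ → UniquelyExtendible C → UniquelyExtendible C′
  UniquelyExtendible-≗ C≗C′ ue t j with ue t j
  ... | v , Cv , unique = v , trans (sym (C≗C′ _)) Cv , λ w C′w → unique w (trans (C≗C′ _) C′w)

  permuteAt : Permutation′ d → Fin k → Tuple d k → Tuple d k
  permuteAt π j t = t [ j ]%= (π ⟨$⟩ʳ_)

  permuteAt-inverse : ∀ π j t → permuteAt (flip π) j (permuteAt π j t) ≡ t
  permuteAt-inverse π j t = trans (updateAt-updateAt j t) (updateAt-id-local j t (inverseˡ π))

  permuteAt-≔ : ∀ π j t w → permuteAt π j (t [ j ]≔ w) ≡ t [ j ]≔ (π ⟨$⟩ʳ w)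
  permuteAt-≔ π j t w = updateAt-updateAt j t

  permuteAt-≔-≢ : ∀ π {j j′} t w → j′ ≢ j → permuteAt π j (t [ j′ ]≔ w) ≡ permuteAt π j t [ j′ ]≔ w
  permuteAt-≔-≢ π {j} {j′} t w j′≢j = updateAt-commutes j j′ (j′≢j ∘ sym) t

  UniquelyExtendible-permuteAt : ∀ π j {C} → UniquelyExtendible C → UniquelyExtendible (C ∘ permuteAt π j)
  UniquelyExtendible-permuteAt π j {C} ue t j′ with j′ ≟ᶠ j
  ... | yes refl with ue t j
  ...   | v , Cv , unique =
    π ⟨$⟩ˡ v ,
    trans (cong C (trans (permuteAt-≔ π j t _) (cong (t [ j ]≔_) (inverseʳ π)))) Cv ,
    λ w Cπw → trans (sym (inverseˡ π)) (cong (π ⟨$⟩ˡ_) (unique _ (trans (cong C (sym (permuteAt-≔ π j t w))) Cπw)))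
  UniquelyExtendible-permuteAt π j {C} ue t j′ | no j′≢j with ue (permuteAt π j t) j′
  ...   | v , Cv , unique =
    v ,
    trans (cong C (permuteAt-≔-≢ π t v j′≢j)) Cv ,
    λ w Cπw → unique w (trans (cong C (sym (permuteAt-≔-≢ π t w j′≢j))) Cπw)

  𝟙-UniquelyExtendible-permuteAt : ∀ π j C →
    𝟙 (UniquelyExtendible? (C ∘ permuteAt π j)) ≡ 𝟙 (UniquelyExtendible? C)
  𝟙-UniquelyExtendible-permuteAt π j C = 𝟙-cong
    (λ ue → UniquelyExtendible-≗ (cong C ∘ permuteAt-inverse (flip π) j)
                                 (UniquelyExtendible-permuteAt (flip π) j {C ∘ permuteAt π j} ue))
    (UniquelyExtendible-permuteAt π j {C})
    (UniquelyExtendible? (C ∘ permuteAt π j)) (UniquelyExtendible? C)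

  𝟙-UniquelyExtendible-≗ : ∀ {C C′} → C ≗ C′ → 𝟙 (UniquelyExtendible? C) ≡ 𝟙 (UniquelyExtendible? C′)
  𝟙-UniquelyExtendible-≗ {C} {C′} C≗C′ =
    𝟙-cong (UniquelyExtendible-≗ C≗C′) (UniquelyExtendible-≗ (sym ∘ C≗C′))
           (UniquelyExtendible? C) (UniquelyExtendible? C′)

  UniquelyExtendible⇒∑-extensions : ∀ {C : Constraint d k} → UniquelyExtendible C → ∀ t j →
    ∑ (allFin d) (λ v → 𝟙 (C (t [ j ]≔ v) ≟ᵇ true)) ≡ 1
  UniquelyExtendible⇒∑-extensions {C} ue t j with ue t j
  ... | v₀ , Cv₀ , unique = begin
    ∑ (allFin d) (λ v → 𝟙 (C (t [ j ]≔ v) ≟ᵇ true))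
      ≡⟨ ∑-cong (allFin d) (λ v → 𝟙-cong (unique v) (λ { refl → Cv₀ }) (C (t [ j ]≔ v) ≟ᵇ true) (v ≟ᶠ v₀)) ⟩
    multiplicity _≟ᶠ_ (allFin d) v₀
      ≡⟨ multiplicity-allFin v₀ ⟩
    1 ∎

module _ {d k : ℕ} where

  private
    L : List (Constraint d k)
    L = allConstraints d k

  sat₁ : Tuple d k → Constraint d k → ℕ
  sat₁ a C = 𝟙 (UniquelyExtendible? C) * 𝟙 (C a ≟ᵇ true)

  sat₂ : Tuple d k → Tuple d k → Constraint d k → ℕ
  sat₂ a b C = 𝟙 (UniquelyExtendible? C) * 𝟙 ((C a ≟ᵇ true) ×-dec (C b ≟ᵇ true))

  N₁ : Tuple d k → ℕ
  N₁ a = ∑ L (sat₁ a)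

  N₂ : Tuple d k → Tuple d k → ℕ
  N₂ a b = ∑ L (sat₂ a b)

  countSat₁≡N₁ : ∀ a → countSat₁ a ≡ N₁ a
  countSat₁≡N₁ a = length-filter-filter UniquelyExtendible? (λ C → C a ≟ᵇ true) L

  countSat₂≡N₂ : ∀ a b → countSat₂ a b ≡ N₂ a b
  countSat₂≡N₂ a b = length-filter-filter UniquelyExtendible? (λ C → (C a ≟ᵇ true) ×-dec (C b ≟ᵇ true)) L

  N₂-diag : ∀ a → N₂ a a ≡ N₁ a
  N₂-diag a = ∑-cong L (λ C → cong (𝟙 (UniquelyExtendible? C) *_)
    (𝟙-cong proj₁ (λ Ca → Ca , Ca) ((C a ≟ᵇ true) ×-dec (C a ≟ᵇ true)) (C a ≟ᵇ true)))

  sat₂-≗ : ∀ a b → Extensional (sat₂ a b)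
  sat₂-≗ a b C≗C′ = cong₂ _*_ (𝟙-UniquelyExtendible-≗ C≗C′)
    (cong₂ (λ x y → 𝟙 ((x ≟ᵇ true) ×-dec (y ≟ᵇ true))) (C≗C′ a) (C≗C′ b))

  sat₂-permuteAt : ∀ a b π j C → π ⟨$⟩ʳ lookup a j ≡ lookup a j →
                   sat₂ a b (C ∘ permuteAt π j) ≡ sat₂ a (permuteAt π j b) C
  sat₂-permuteAt a b π j C πa≡a = cong₂ _*_ (𝟙-UniquelyExtendible-permuteAt π j C)
    (cong (λ x → 𝟙 ((C x ≟ᵇ true) ×-dec (C (permuteAt π j b) ≟ᵇ true))) (updateAt-id-local j a πa≡a))

  -- C ↦ C ∘ permuteAt π j permutes Γ, and fixes the condition C(a) since π fixes a_j.
  N₂-permuteAt : ∀ a b π j → π ⟨$⟩ʳ lookup a j ≡ lookup a j → N₂ a (permuteAt π j b) ≡ N₂ a b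
  N₂-permuteAt a b π j πa≡a = begin
    ∑ L (sat₂ a (permuteAt π j b))             ≡⟨ ∑-cong L (λ C → sat₂-permuteAt a b π j C πa≡a) ⟨
    ∑ L (λ C → sat₂ a b (C ∘ permuteAt π j))   ≡⟨ ∑-allConstraints-∘ (permuteAt π j) (permuteAt (flip π) j)
                                                     (permuteAt-inverse (flip π) j) (permuteAt-inverse π j)
                                                     (sat₂ a b) (sat₂-≗ a b) ⟩
    N₂ a b                                     ∎

  N₂-≔-≢ : ∀ a b j v → lookup a j ≢ lookup b j → lookup a j ≢ v → N₂ a (b [ j ]≔ v) ≡ N₂ a b
  N₂-≔-≢ a b j v aj≢bj aj≢v = begin
    N₂ a (b [ j ]≔ v)             ≡⟨ cong (N₂ a) (updateAt-cong-local j b (transpose-matchˡ (lookup b j) v)) ⟨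
    N₂ a (permuteAt swap j b)     ≡⟨ N₂-permuteAt a b swap j (transpose-fix (lookup b j) v (lookup a j) aj≢bj aj≢v) ⟩
    N₂ a b                        ∎
    where
    swap : Permutation′ d
    swap = transpose (lookup b j) v

  ∑-N₂-≔ : ∀ a c j → ∑ (allFin d) (λ v → N₂ a (c [ j ]≔ v)) ≡ N₁ a
  ∑-N₂-≔ a c j = trans (∑-comm (allFin d) L (λ v → sat₂ a (c [ j ]≔ v))) (∑-cong L column)
    where
    extensions : Constraint d k → ℕ
    extensions C = ∑ (allFin d) (λ v → 𝟙 (C (c [ j ]≔ v) ≟ᵇ true))

    collapse : ∀ C (ue? : Dec (UniquelyExtendible C)) (m : ℕ) → 𝟙 ue? * (m * extensions C) ≡ 𝟙 ue? * m
    collapse C (yes ue) m = trans (cong (λ n → 1 * (m * n)) (UniquelyExtendible⇒∑-extensions {C = C} ue c j))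
                                  (cong (1 *_) (*-identityʳ m))
    collapse C (no _)   m = refl

    column : ∀ C → ∑ (allFin d) (λ v → sat₂ a (c [ j ]≔ v) C) ≡ sat₁ a C
    column C = begin
        ∑ (allFin d) (λ v → 𝟙 (UniquelyExtendible? C) * 𝟙 ((C a ≟ᵇ true) ×-dec (C (c [ j ]≔ v) ≟ᵇ true)))
      ≡⟨ ∑-*ˡ (allFin d) (𝟙 (UniquelyExtendible? C)) _ ⟩
        𝟙 (UniquelyExtendible? C) * ∑ (allFin d) (λ v → 𝟙 ((C a ≟ᵇ true) ×-dec (C (c [ j ]≔ v) ≟ᵇ true)))
      ≡⟨ cong (𝟙 (UniquelyExtendible? C) *_)
              (trans (∑-cong (allFin d) (λ v → 𝟙-× (C a ≟ᵇ true) (C (c [ j ]≔ v) ≟ᵇ true)))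
                     (∑-*ˡ (allFin d) (𝟙 (C a ≟ᵇ true)) _)) ⟩
        𝟙 (UniquelyExtendible? C) * (𝟙 (C a ≟ᵇ true) * extensions C)
      ≡⟨ collapse C (UniquelyExtendible? C) (𝟙 (C a ≟ᵇ true)) ⟩
        sat₁ a C
      ∎

N₁≡N₂-≔+N₂ : ∀ {e k} (a b : Tuple (suc e) k) j → lookup a j ≢ lookup b j →
             N₁ a ≡ N₂ a (b [ j ]≔ lookup a j) + e * N₂ a b
N₁≡N₂-≔+N₂ {e} a b j aj≢bj = +-cancelʳ-≡ X (N₁ a) (Y + e * X) (begin
  N₁ a + X                                          ≡⟨ cong (_+ X) (∑-N₂-≔ a b j) ⟨
  ∑ (allFin (suc e)) (λ v → N₂ a (b [ j ]≔ v)) + X  ≡⟨ ∑-allFin-except _ (lookup a j) X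
                                                          (λ v v≢aj → N₂-≔-≢ a b j v aj≢bj (v≢aj ∘ sym)) ⟩
  Y + (X + e * X)                                   ≡⟨ x∙yz≈y∙xz Y X (e * X) ⟩
  X + (Y + e * X)                                   ≡⟨ +-comm X _ ⟩
  Y + e * X + X                                     ∎)
  where
  X = N₂ a b
  Y = N₂ a (b [ j ]≔ lookup a j)

-- The recurrence along the Hamming distance

module _ {d : ℕ} where

  hamming-∷-≡ : ∀ {k} x (a b : Tuple d k) → hamming (x ∷ a) (x ∷ b) ≡ hamming a b
  hamming-∷-≡ x a b rewrite dec-true (x ≟ᶠ x) refl = refl

  hamming≡0⇒≡ : ∀ {k} (a b : Tuple d k) → hamming a b ≡ 0 → a ≡ b
  hamming≡0⇒≡ []      []      _ = refl
  hamming≡0⇒≡ (x ∷ a) (y ∷ b) h with x ≟ᶠ y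
  ... | yes refl = cong (x ∷_) (hamming≡0⇒≡ a b h)
  ... | no  _    with h
  ...   | ()

  hamming≡suc⇒ : ∀ {k} (a b : Tuple d k) i → hamming a b ≡ suc i →
                 Σ (Fin k) λ j → lookup a j ≢ lookup b j × hamming a (b [ j ]≔ lookup a j) ≡ i
  hamming≡suc⇒ []      []      i ()
  hamming≡suc⇒ (x ∷ a) (y ∷ b) i h with x ≟ᶠ y
  ... | yes refl with hamming≡suc⇒ a b i h
  ...   | j , aj≢bj , h′ = suc j , aj≢bj , trans (hamming-∷-≡ x a _) h′
  hamming≡suc⇒ (x ∷ a) (y ∷ b) i h | no x≢y = zero , x≢y , trans (hamming-∷-≡ x a b) (suc-injective h)

pos-*-* : ∀ m n o → + (m * n * o) ≡ + m *ℤ + n *ℤ + o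
pos-*-* m n o = trans (pos-* (m * n) o) (cong (_*ℤ + o) (pos-* m n))

pos-+-* : ∀ m n o → + (m + n * o) ≡ + m +ℤ + n *ℤ + o
pos-+-* m n o = trans (pos-+ m (n * o)) (cong (λ z → + m +ℤ z) (pos-* n o))

-- The induction step, with n = N₁ a, p = e^i, s = (-1)^i, x = N₂ a b and y = N₂ a (b[j]≔a_j).
formula-step : ∀ e p {n x y} (s : ℤ) → n ≡ y + e * x →
               + (suc e * p * y) ≡ + n *ℤ (+ p +ℤ s *ℤ + e) →
               + (suc e * (e * p) * x) ≡ + n *ℤ (+ (e * p) +ℤ (- + 1 *ℤ s) *ℤ + e)
formula-step e p {x = x} {y} s refl formula-y = begin
    + (suc e * (e * p) * x)
  ≡⟨ trans (pos-*-* (suc e) (e * p) x) (cong (λ q → D *ℤ q *ℤ X) (pos-* e p)) ⟩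
    D *ℤ (E *ℤ P) *ℤ X
  ≡⟨ expand E P X Y ⟩
    D *ℤ P *ℤ (Y +ℤ E *ℤ X) +ℤ - (D *ℤ P *ℤ Y)
  ≡⟨ cong (λ q → D *ℤ P *ℤ (Y +ℤ E *ℤ X) +ℤ - q) formula-Y ⟩
    D *ℤ P *ℤ (Y +ℤ E *ℤ X) +ℤ - ((Y +ℤ E *ℤ X) *ℤ (P +ℤ s *ℤ E))
  ≡⟨ collect E P X Y s ⟩
    (Y +ℤ E *ℤ X) *ℤ (E *ℤ P +ℤ (- + 1 *ℤ s) *ℤ E)
  ≡⟨ cong₂ (λ q r → q *ℤ (r +ℤ (- + 1 *ℤ s) *ℤ E)) (pos-+-* y e x) (pos-* e p) ⟨
    + (y + e * x) *ℤ (+ (e * p) +ℤ (- + 1 *ℤ s) *ℤ E)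
  ∎
  where
  E = + e
  D = + 1 +ℤ E
  P = + p
  X = + x
  Y = + y

  formula-Y : D *ℤ P *ℤ Y ≡ (Y +ℤ E *ℤ X) *ℤ (P +ℤ s *ℤ E)
  formula-Y = trans (sym (pos-*-* (suc e) p y)) (trans formula-y (cong (_*ℤ (P +ℤ s *ℤ E)) (pos-+-* y e x)))

  expand : ∀ E P X Y → (+ 1 +ℤ E) *ℤ (E *ℤ P) *ℤ X
                       ≡ (+ 1 +ℤ E) *ℤ P *ℤ (Y +ℤ E *ℤ X) +ℤ - ((+ 1 +ℤ E) *ℤ P *ℤ Y)
  expand = ℤ-Solver.solve-∀

  collect : ∀ E P X Y s → (+ 1 +ℤ E) *ℤ P *ℤ (Y +ℤ E *ℤ X) +ℤ - ((Y +ℤ E *ℤ X) *ℤ (P +ℤ s *ℤ E))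
                          ≡ (Y +ℤ E *ℤ X) *ℤ (E *ℤ P +ℤ (- + 1 *ℤ s) *ℤ E)
  collect = ℤ-Solver.solve-∀

N₂-formula : ∀ {e k} (a b : Tuple (suc e) k) i → hamming a b ≡ i →
             + (suc e * e ^ i * N₂ a b) ≡ + N₁ a *ℤ (+ (e ^ i) +ℤ (- + 1) ^ℤ i *ℤ + e)
N₂-formula {e} a b zero h with hamming≡0⇒≡ a b h
... | refl = begin
  + (suc e * 1 * N₂ a a)              ≡⟨ cong (λ n → + (suc e * 1 * n)) (N₂-diag a) ⟩
  + (suc e * 1 * N₁ a)                ≡⟨ pos-*-* (suc e) 1 (N₁ a) ⟩
  (+ 1 +ℤ + e) *ℤ + 1 *ℤ + N₁ a        ≡⟨ base (+ e) (+ N₁ a) ⟩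
  + N₁ a *ℤ (+ 1 +ℤ + 1 *ℤ + e)        ∎
  where
  base : ∀ E n → (+ 1 +ℤ E) *ℤ + 1 *ℤ n ≡ n *ℤ (+ 1 +ℤ + 1 *ℤ E)
  base = ℤ-Solver.solve-∀
N₂-formula {e} a b (suc i) h with hamming≡suc⇒ a b i h
... | j , aj≢bj , h′ = formula-step e (e ^ i) ((- + 1) ^ℤ i) (N₁≡N₂-≔+N₂ a b j aj≢bj)
                                    (N₂-formula a (b [ j ]≔ lookup a j) i h′)

-- A uniquely extendible constraint through any given tuple

module _ {d : ℕ} .{{_ : NonZero d}} where

  digitSum : ∀ {k} → Tuple d k → ℕ
  digitSum []      = 0
  digitSum (x ∷ t) = toℕ x + digitSum t

  digitSum-≔ : ∀ {k} (t : Tuple d (suc k)) j v → digitSum (t [ j ]≔ v) ≡ toℕ v + digitSum (removeAt t j)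
  digitSum-≔ (x ∷ t)     zero    v = refl
  digitSum-≔ (x ∷ y ∷ t) (suc j) v =
    trans (cong (_+_ (toℕ x)) (digitSum-≔ (y ∷ t) j v)) (x∙yz≈y∙xz (toℕ x) (toℕ v) _)

  +[d∸%]≡ : ∀ r → r + (d ∸ r % d) ≡ suc (r / d) * d
  +[d∸%]≡ r = begin
    r + (d ∸ r % d)                  ≡⟨ cong (_+ (d ∸ r % d)) (m≡m%n+[m/n]*n r d) ⟩
    r % d + r / d * d + (d ∸ r % d)  ≡⟨ xy∙z≈xz∙y (r % d) _ _ ⟩
    r % d + (d ∸ r % d) + r / d * d  ≡⟨ cong (_+ r / d * d) (m+[n∸m]≡n (<⇒≤ (m%n<n r d))) ⟩
    d + r / d * d                    ∎

  [m+r+[d∸r%d]]%d≡m%d : ∀ m r → (m + r + (d ∸ r % d)) % d ≡ m % d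
  [m+r+[d∸r%d]]%d≡m%d m r = begin
    (m + r + (d ∸ r % d)) % d    ≡⟨ cong (_% d) (+-assoc m r _) ⟩
    (m + (r + (d ∸ r % d))) % d  ≡⟨ cong (λ n → (m + n) % d) (+[d∸%]≡ r) ⟩
    (m + suc (r / d) * d) % d    ≡⟨ [m+kn]%n≡m%n m (suc (r / d)) d ⟩
    m % d                        ∎

  [m%d+n]%d≡[m+n]%d : ∀ m n → (m % d + n) % d ≡ (m + n) % d
  [m%d+n]%d≡[m+n]%d m n = begin
    (m % d + n) % d          ≡⟨ %-distribˡ-+ (m % d) n d ⟩
    (m % d % d + n % d) % d  ≡⟨ cong (λ x → (x + n % d) % d) (m%n%n≡m%n m d) ⟩
    (m % d + n % d) % d      ≡⟨ %-distribˡ-+ m n d ⟨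
    (m + n) % d              ∎

  +-%-ExactlyOne : ∀ {s} → s < d → ∀ r → ExactlyOne (λ (v : Fin d) → (toℕ v + r) % d ≡ s)
  +-%-ExactlyOne {s} s<d r = v₀ , solves , unique
    where
    c = d ∸ r % d

    v₀ : Fin d
    v₀ = fromℕ< (m%n<n (s + c) d)

    solves : (toℕ v₀ + r) % d ≡ s
    solves = begin
      (toℕ v₀ + r) % d     ≡⟨ cong (λ x → (x + r) % d) (toℕ-fromℕ< (m%n<n (s + c) d)) ⟩
      ((s + c) % d + r) % d ≡⟨ [m%d+n]%d≡[m+n]%d (s + c) r ⟩
      (s + c + r) % d      ≡⟨ cong (_% d) (xy∙z≈xz∙y s c r) ⟩
      (s + r + c) % d      ≡⟨ [m+r+[d∸r%d]]%d≡m%d s r ⟩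
      s % d                ≡⟨ m<n⇒m%n≡m s<d ⟩
      s                    ∎

    unique : ∀ w → (toℕ w + r) % d ≡ s → w ≡ v₀
    unique w w-solves = toℕ-injective (begin
      toℕ w                      ≡⟨ m<n⇒m%n≡m (toℕ<n w) ⟨
      toℕ w % d                  ≡⟨ [m+r+[d∸r%d]]%d≡m%d (toℕ w) r ⟨
      (toℕ w + r + c) % d        ≡⟨ [m%d+n]%d≡[m+n]%d (toℕ w + r) c ⟨
      ((toℕ w + r) % d + c) % d  ≡⟨ cong (λ x → (x + c) % d) w-solves ⟩
      (s + c) % d                ≡⟨ toℕ-fromℕ< (m%n<n (s + c) d) ⟨
      toℕ v₀                     ∎)

  digitSum≡ : ∀ {k} → ℕ → Constraint d k
  digitSum≡ s t = does (digitSum t % d ≟ℕ s)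

  digitSum≡-UniquelyExtendible : ∀ {k s} → s < d → UniquelyExtendible (digitSum≡ {k} s)
  digitSum≡-UniquelyExtendible {suc k} {s} s<d t j with +-%-ExactlyOne s<d (digitSum (removeAt t j))
  ... | v , solves , unique =
    v , dec-true (_ ≟ℕ s) (trans (cong (_% d) (digitSum-≔ t j v)) solves) ,
    λ w holds → unique w (trans (cong (_% d) (sym (digitSum-≔ t j w))) (does⇒ (_ ≟ℕ s) holds))
    where
    does⇒ : {P : Set} (p : Dec P) → does p ≡ true → P
    does⇒ (yes x) _ = x

-- Exactly one entry of allConstraints agrees with C₀, and it is in Γ and true at a.
N₁-positive : ∀ {e k} (a : Tuple (suc e) k) → 0 < N₁ a
N₁-positive {e} {k} a = subst (_≤ N₁ a) (allConstraints-once C₀) (∑-mono (allConstraints (suc e) k) ≈C₀⇒sat₁)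
  where
  C₀ : Constraint (suc e) k
  C₀ = digitSum≡ (digitSum a % suc e)

  C₀-UniquelyExtendible : UniquelyExtendible C₀
  C₀-UniquelyExtendible = digitSum≡-UniquelyExtendible (m%n<n (digitSum a) (suc e))

  C₀a : C₀ a ≡ true
  C₀a = dec-true (digitSum a % suc e ≟ℕ digitSum a % suc e) refl

  ≈C₀⇒sat₁ : ∀ C → 𝟙 (C ≈ᶜ? C₀) ≤ sat₁ a C
  ≈C₀⇒sat₁ C with C ≈ᶜ? C₀
  ... | no  _    = z≤n
  ... | yes C≈C₀ rewrite 𝟙-yes (UniquelyExtendible-≗ (sym ∘ ≈ᶜ⇒≗ C≈C₀) C₀-UniquelyExtendible) (UniquelyExtendible? C)
                       | 𝟙-yes (trans (≈ᶜ⇒≗ C≈C₀ a) C₀a) (C a ≟ᵇ true) = s≤s z≤n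

-- With d = suc e, the term d ∸ 1 of the statement reduces to e.
lemma12 : (d k : ℕ) → 2 ≤ d → 2 ≤ k → (i : ℕ) → i ≤ k →
          (a b : Tuple d k) → hamming a b ≡ i →
          0 < countSat₁ a ×
          + (d * (d ∸ 1) ^ i * countSat₂ a b)
            ≡ + countSat₁ a *ℤ (+ ((d ∸ 1) ^ i) +ℤ (- + 1) ^ℤ i *ℤ + (d ∸ 1))
lemma12 (suc e) k _ _ i _ a b h rewrite countSat₁≡N₁ a | countSat₂≡N₂ a b =
  N₁-positive a , N₂-formula a b i h
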